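{- For every $n\ge2$, $K_{n+4}=5K_{n+2}-4K_n$, where $K_m$ is the number of non-colourable strings in $\{0,1\}^m$.
   Context: $\#w$ is the length, $\varepsilon$ the empty string; for $\#w\ge1$, $l(w)$ is $w$ without its last letter and $r(w)$ is $w$ without its first letter. $T^n$ is the alternating string of length $n$ starting with $0$ ($T^0=\varepsilon$, $T^n=T^{n-1}0$ for odd $n$, $T^n=T^{n-1}1$ for even $n\ge2$) and $CT^n$ its letterwise complement. $\xi$: $\xi(\varepsilon)=0$; $\xi(w)=1$ if $w=T^k$, $k\ge2$ even; $\xi(w)=-1$ if $w=CT^k$, $k\ge2$ even; otherwise $\xi(w)=\operatorname{sgn}(\xi(l(w))+\xi(r(w)))$. $\phi$: $\phi(\varepsilon)=0$; $\phi(w)=-1$ if $w=0^k$, $k$ odd; $\phi(w)=1$ if $w=1^k$, $k$ odd; otherwise $\phi(w)=\operatorname{sgn}(\phi(r(w))-\phi(l(w)))$. $\psi(w)=\xi(w)^{\#w}\phi(w)$ (with $0^0=1$); $w$ is colourable iff $\psi(w)\ne0$. $K_n=\#\{w\in\{0,1\}^n:\psi(w)=0\}$. -}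

module Defs where

open import Data.Bool using (Bool; true; false; not; if_then_else_; _∧_)
open import Data.Nat using (ℕ; zero; suc; _≤ᵇ_)
open import Data.Integer using (ℤ; +_; -[1+_]; _+_; _-_; _^_; 0ℤ; 1ℤ; -1ℤ)
open import Data.Vec using (Vec; []; _∷_; _∷ʳ_; init; tail; replicate; map)
open import Data.List using (List; []; _∷_; _++_; length; filter)
import Data.List as L
open import Relation.Nullary using (Dec; yes; no; does)
open import Relation.Nullary.Decidable using (⌊_⌋)
import Data.Vec.Properties as VP
import Data.Bool.Properties as BP
import Data.Integer.Properties as ZP
open import Relation.Binary.PropositionalEquality using (_≡_)

-- Binary strings of length n: Vec Bool n, with false = letter 0, true = letter 1.

even? : ℕ → Bool
even? zero = true
even? (suc n) = not (even? n)

sgn : ℤ → ℤ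
sgn (+ zero) = 0ℤ
sgn (+ suc _) = 1ℤ
sgn -[1+ _ ] = -1ℤ

l : ∀ {n} → Vec Bool (suc n) → Vec Bool n
l = init

r : ∀ {n} → Vec Bool (suc n) → Vec Bool n
r = tail

T : (n : ℕ) → Vec Bool n
T zero = []
T (suc n) = T n ∷ʳ (if even? (suc n) then true else false)

CT : (n : ℕ) → Vec Bool n
CT n = map not (T n)

_≟v_ : ∀ {n} → (u v : Vec Bool n) → Dec (u ≡ v)
_≟v_ = VP.≡-dec BP._≟_

-- "w = T^k with k ≥ 2 even" (k is necessarily the length of w)
isTeven : ∀ {n} → Vec Bool n → Bool
isTeven {n} w = (2 ≤ᵇ n) ∧ even? n ∧ ⌊ w ≟v T n ⌋

isCTeven : ∀ {n} → Vec Bool n → Bool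
isCTeven {n} w = (2 ≤ᵇ n) ∧ even? n ∧ ⌊ w ≟v CT n ⌋

isZeroOdd : ∀ {n} → Vec Bool n → Bool
isZeroOdd {n} w = not (even? n) ∧ ⌊ w ≟v replicate n false ⌋

isOneOdd : ∀ {n} → Vec Bool n → Bool
isOneOdd {n} w = not (even? n) ∧ ⌊ w ≟v replicate n true ⌋

ξ : ∀ {n} → Vec Bool n → ℤ
ξ {zero} w = 0ℤ
ξ {suc n} w =
  if isTeven w then 1ℤ
  else if isCTeven w then -1ℤ
  else sgn (ξ (l w) + ξ (r w))

φ : ∀ {n} → Vec Bool n → ℤ
φ {zero} w = 0ℤ
φ {suc n} w =
  if isZeroOdd w then -1ℤ
  else if isOneOdd w then 1ℤ
  else sgn (φ (r w) - φ (l w))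

-- ψ(w) = ξ(w)^{#w} φ(w)   (stdlib: x ^ 0 = 1, so 0^0 = 1)
ψ : ∀ {n} → Vec Bool n → ℤ
ψ {n} w = (ξ w ^ n) Data.Integer.* φ w

allStrings : (n : ℕ) → List (Vec Bool n)
allStrings zero = [] ∷ []
allStrings (suc n) = L.map (false ∷_) (allStrings n) ++ L.map (true ∷_) (allStrings n)

K : ℕ → ℕ
K n = length (filter (λ w → ψ w ZP.≟ 0ℤ) (allStrings n))

-- Write a string of length n + 2 as a ∷ (u ∷ʳ b). Both ξ and φ obey a peeling law: ξ (a u b) = ξ u and
-- φ (a u b) = - φ u, except when u is one of the four special strings 0ⁿ, 1ⁿ, Tⁿ, CTⁿ and the letters a, b
-- and the parity of n are in one of finitely many configurations, where the value is ±1. The laws are proved by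
-- induction on n: for a generic inner string the defining recursion commutes with peeling symbolically, and for
-- special ones the values are determined by parity, so the remaining cases are finitely many and are decided
-- by evaluation. Peeling shows that φ v = 0 forces ξ v = 0, so ψ v = 0 exactly when ξ v = 0. Counting the
-- strings of length n + 2 by their end letters then gives K (n + 2) = 4 K n - d n, where d n only counts special
-- strings and, for n ≥ 2, depends only on the parity of n; subtracting two consecutive instances gives the
-- recurrence.

module Submission where

open import Defs
open import Algebra.Bundles using (CommutativeMonoid)
open import Data.Bool using (Bool; true; false; not; _∧_; _∨_; _xor_; if_then_else_)
import Data.Bool.Properties as Boolₚ
open import Data.Nat using (ℕ; zero; suc; _≤_; _+_; s≤s; z≤n)
import Data.Nat as ℕ
open import Data.Integer using (ℤ; +_; _-_; _*_; _⊖_; 0ℤ; 1ℤ; -1ℤ)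
import Data.Integer as ℤ
import Data.Integer.Properties as ℤₚ
import Data.Nat.Properties as ℕₚ
open import Data.Product using (_×_; _,_; proj₁; proj₂)
open import Data.Sum using ([_,_]′)
open import Data.List using (List; []; _∷_; _++_; length; filter)
import Data.List as List
import Data.List.Properties as Listₚ
open import Data.Nat.Tactic.RingSolver using (solve-∀)
open import Data.Vec using (Vec; []; _∷_; _∷ʳ_; replicate; map; initLast)
import Data.Vec.Properties as Vecₚ
open import Relation.Binary.PropositionalEquality
open import Relation.Nullary using (Dec; does; yes; no)
open import Relation.Nullary.Decidable
  using (⌊_⌋; from-yes; map′; _×-dec_; _→-dec_; dec-true; dec-false; isYes≗does)
open import Relation.Unary using (Decidable)

open import Algebra.Properties.CommutativeSemigroup
  (CommutativeMonoid.commutativeSemigroup Boolₚ.∧-commutativeMonoid) using (x∙yz≈y∙xz)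
open import Algebra.Properties.CommutativeSemigroup ℕₚ.+-commutativeSemigroup
  using () renaming (interchange to +-interchange; x∙yz≈xz∙y to +-pull-right)

∀?-Bool : {P : Bool → Set} → Decidable P → Dec (∀ b → P b)
∀?-Bool P? = map′ (λ (p , q) → λ { false → p ; true → q }) (λ h → h false , h true)
  (P? false ×-dec P? true)

∀?-Vec : ∀ n {P : Vec Bool n → Set} → Decidable P → Dec (∀ v → P v)
∀?-Vec zero P? = map′ (λ { p [] → p }) (λ h → h []) (P? [])
∀?-Vec (suc n) P? = map′ (λ { h (x ∷ v) → h x v }) (λ h x v → h (x ∷ v))
  (∀?-Bool λ x → ∀?-Vec n (λ v → P? (x ∷ v)))

_≐_ : Bool → Bool → Bool
x ≐ y = does (x Boolₚ.≟ y)

_==_ : ∀ {n} → Vec Bool n → Vec Bool n → Bool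
u == v = does (u ≟v v)

==-refl : ∀ {n} (u : Vec Bool n) → u == u ≡ true
==-refl u = dec-true (u ≟v u) refl

==⇒≡ : ∀ {n} (u v : Vec Bool n) → u == v ≡ true → u ≡ v
==⇒≡ u v h with u ≟v v
... | yes u≡v = u≡v

==-∷ : ∀ {n} x y (u v : Vec Bool n) → (x ∷ u) == (y ∷ v) ≡ (u == v) ∧ (x ≐ y)
==-∷ x y u v = Boolₚ.∧-comm (x ≐ y) (u == v)

==-∷ʳ : ∀ {n} (u v : Vec Bool n) x y → (u ∷ʳ x) == (v ∷ʳ y) ≡ (u == v) ∧ (x ≐ y)
==-∷ʳ [] [] x y = Boolₚ.∧-identityʳ (x ≐ y)
==-∷ʳ (a ∷ u) (b ∷ v) x y = begin
  (a ≐ b) ∧ ((u ∷ʳ x) == (v ∷ʳ y)) ≡⟨ cong ((a ≐ b) ∧_) (==-∷ʳ u v x y) ⟩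
  (a ≐ b) ∧ ((u == v) ∧ (x ≐ y))   ≡⟨ sym (Boolₚ.∧-assoc (a ≐ b) (u == v) (x ≐ y)) ⟩
  ((a ≐ b) ∧ (u == v)) ∧ (x ≐ y)   ∎
  where open ≡-Reasoning

data Enclosed {n} : Vec Bool (suc (suc n)) → Set where
  enclosed : ∀ a (u : Vec Bool n) b → Enclosed (a ∷ (u ∷ʳ b))

enclosed? : ∀ {n} (w : Vec Bool (suc (suc n))) → Enclosed w
enclosed? (a ∷ v) with initLast v
... | u , b , refl = enclosed a u b

-- Special strings and profiles

data Special : Set where
  zeros ones alt coalt : Special

special : Special → (n : ℕ) → Vec Bool n
special zeros n = replicate n false
special ones  n = replicate n true
special alt   n = T n
special coalt n = CT n

first : Special → Bool
first zeros = false
first ones  = true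
first alt   = false
first coalt = true

dual : Special → Special
dual zeros = zeros
dual ones  = ones
dual alt   = coalt
dual coalt = alt

-- The last letter of special s (suc n), as a function of even? n.
last : Special → Bool → Bool
last zeros e = false
last ones  e = true
last alt   e = not e
last coalt e = e

∀?-Special : {P : Special → Set} → Decidable P → Dec (∀ s → P s)
∀?-Special P? = map′
  (λ (p , q , r , t) → λ { zeros → p ; ones → q ; alt → r ; coalt → t })
  (λ h → h zeros , h ones , h alt , h coalt)
  (P? zeros ×-dec P? ones ×-dec P? alt ×-dec P? coalt)

T-∷ʳ : ∀ n → T (suc n) ≡ T n ∷ʳ not (even? n)
T-∷ʳ n = cong (T n ∷ʳ_) (if-id (not (even? n)))
  where
  if-id : ∀ b → (if b then true else false) ≡ b
  if-id true  = refl
  if-id false = refl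

T-suc : ∀ n → T (suc n) ≡ false ∷ CT n
T-suc zero    = refl
T-suc (suc n) = begin
  T (suc (suc n))                        ≡⟨ T-∷ʳ (suc n) ⟩
  T (suc n) ∷ʳ not (even? (suc n))       ≡⟨ cong (_∷ʳ not (even? (suc n))) (T-suc n) ⟩
  false ∷ (CT n ∷ʳ not (not (even? n)))  ≡⟨ cong (false ∷_) (sym (Vecₚ.map-∷ʳ not (not (even? n)) (T n))) ⟩
  false ∷ map not (T n ∷ʳ not (even? n)) ≡⟨ cong (λ v → false ∷ map not v) (sym (T-∷ʳ n)) ⟩
  false ∷ CT (suc n)                     ∎
  where open ≡-Reasoning

CT-suc : ∀ n → CT (suc n) ≡ true ∷ T n
CT-suc n = begin
  map not (T (suc n))                  ≡⟨ cong (map not) (T-suc n) ⟩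
  true ∷ map not (map not (T n))       ≡⟨ cong (true ∷_) (sym (Vecₚ.map-∘ not not (T n))) ⟩
  true ∷ map (λ x → not (not x)) (T n) ≡⟨ cong (true ∷_) (Vecₚ.map-cong Boolₚ.not-involutive (T n)) ⟩
  true ∷ map (λ x → x) (T n)           ≡⟨ cong (true ∷_) (Vecₚ.map-id (T n)) ⟩
  true ∷ T n                           ∎
  where open ≡-Reasoning

replicate-∷ʳ : ∀ n (x : Bool) → replicate (suc n) x ≡ replicate n x ∷ʳ x
replicate-∷ʳ zero    x = refl
replicate-∷ʳ (suc n) x = cong (x ∷_) (replicate-∷ʳ n x)

special-suc : ∀ s n → special s (suc n) ≡ first s ∷ special (dual s) n
special-suc zeros n = refl
special-suc ones  n = refl
special-suc alt   n = T-suc n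
special-suc coalt n = CT-suc n

special-∷ʳ : ∀ s n → special s (suc n) ≡ special s n ∷ʳ last s (even? n)
special-∷ʳ zeros n = replicate-∷ʳ n false
special-∷ʳ ones  n = replicate-∷ʳ n true
special-∷ʳ alt   n = T-∷ʳ n
special-∷ʳ coalt n = begin
  map not (T (suc n))                ≡⟨ cong (map not) (T-∷ʳ n) ⟩
  map not (T n ∷ʳ not (even? n))     ≡⟨ Vecₚ.map-∷ʳ not (not (even? n)) (T n) ⟩
  CT n ∷ʳ not (not (even? n))        ≡⟨ cong (CT n ∷ʳ_) (Boolₚ.not-involutive (even? n)) ⟩
  CT n ∷ʳ even? n                    ∎
  where open ≡-Reasoning

special-enclose : ∀ s n →
  special s (suc (suc n)) ≡ first s ∷ (special (dual s) n ∷ʳ last (dual s) (even? n))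
special-enclose s n = trans (special-suc s (suc n)) (cong (first s ∷_) (special-∷ʳ (dual s) n))

dual-involutive : ∀ s → dual (dual s) ≡ s
dual-involutive zeros = refl
dual-involutive ones  = refl
dual-involutive alt   = refl
dual-involutive coalt = refl

special-suc-suc : ∀ s n → special s (suc (suc n)) ≡ first s ∷ first (dual s) ∷ special s n
special-suc-suc s n = trans (special-suc s (suc n)) (cong (first s ∷_) (begin
  special (dual s) (suc n)                    ≡⟨ special-suc (dual s) n ⟩
  first (dual s) ∷ special (dual (dual s)) n  ≡⟨ cong (λ t → first (dual s) ∷ special t n) (dual-involutive s) ⟩
  first (dual s) ∷ special s n                ∎))
  where open ≡-Reasoning

record Profile : Set where
  constructor ⟨_,_,_,_⟩
  field
    isZeros isOnes isAlt isCoalt : Bool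

open Profile

_at_ : Profile → Special → Bool
P at zeros = isZeros P
P at ones  = isOnes P
P at alt   = isAlt P
P at coalt = isCoalt P

tabulate : (Special → Bool) → Profile
tabulate g = ⟨ g zeros , g ones , g alt , g coalt ⟩

tabulate-cong : {g h : Special → Bool} → (∀ s → g s ≡ h s) → tabulate g ≡ tabulate h
tabulate-cong g≗h
  rewrite g≗h zeros | g≗h ones | g≗h alt | g≗h coalt = refl

profile : ∀ {n} → Vec Bool n → Profile
profile {n} u = tabulate λ s → u == special s n

profile-at : ∀ {n} (u : Vec Bool n) s → profile u at s ≡ u == special s n
profile-at u zeros = refl
profile-at u ones  = refl
profile-at u alt   = refl
profile-at u coalt = refl

generic : Profile
generic = ⟨ false , false , false , false ⟩

generic-at : ∀ s → generic at s ≡ false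
generic-at zeros = refl
generic-at ones  = refl
generic-at alt   = refl
generic-at coalt = refl

profileOf : Special → Profile
profileOf zeros = ⟨ true  , false , false , false ⟩
profileOf ones  = ⟨ false , true  , false , false ⟩
profileOf alt   = ⟨ false , false , true  , false ⟩
profileOf coalt = ⟨ false , false , false , true  ⟩

profile-special : ∀ s n → profile (special s (suc (suc n))) ≡ profileOf s
profile-special s n = tabulate-cong λ t →
  trans (cong₂ _==_ (special-suc-suc s n) (special-suc-suc t n)) (compare s t)
  where
  compare : ∀ s t →
    (first s ∷ first (dual s) ∷ special s n) == (first t ∷ first (dual t) ∷ special t n) ≡ profileOf s at t
  compare zeros zeros = ==-refl (special zeros n)
  compare zeros ones  = refl
  compare zeros alt   = refl
  compare zeros coalt = refl
  compare ones  zeros = refl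
  compare ones  ones  = ==-refl (special ones n)
  compare ones  alt   = refl
  compare ones  coalt = refl
  compare alt   zeros = refl
  compare alt   ones  = refl
  compare alt   alt   = ==-refl (special alt n)
  compare alt   coalt = refl
  compare coalt zeros = refl
  compare coalt ones  = refl
  compare coalt alt   = refl
  compare coalt coalt = ==-refl (special coalt n)

cons : Bool → Profile → Profile
cons x P = tabulate λ s → P at dual s ∧ (x ≐ first s)

snoc : Bool → Bool → Profile → Profile
snoc y e P = tabulate λ s → P at s ∧ (y ≐ last s e)

profile-∷ : ∀ {n} x (u : Vec Bool n) → profile (x ∷ u) ≡ cons x (profile u)
profile-∷ {n} x u = tabulate-cong λ s → begin
  (x ∷ u) == special s (suc n)                  ≡⟨ cong ((x ∷ u) ==_) (special-suc s n) ⟩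
  (x ∷ u) == (first s ∷ special (dual s) n)     ≡⟨ ==-∷ x (first s) u (special (dual s) n) ⟩
  (u == special (dual s) n) ∧ (x ≐ first s)     ≡⟨ cong (_∧ (x ≐ first s)) (sym (profile-at u (dual s))) ⟩
  profile u at dual s ∧ (x ≐ first s)           ∎
  where open ≡-Reasoning

profile-∷ʳ : ∀ {n} (u : Vec Bool n) y → profile (u ∷ʳ y) ≡ snoc y (even? n) (profile u)
profile-∷ʳ {n} u y = tabulate-cong λ s → begin
  (u ∷ʳ y) == special s (suc n)                     ≡⟨ cong ((u ∷ʳ y) ==_) (special-∷ʳ s n) ⟩
  (u ∷ʳ y) == (special s n ∷ʳ last s (even? n))     ≡⟨ ==-∷ʳ u (special s n) y (last s (even? n)) ⟩
  (u == special s n) ∧ (y ≐ last s (even? n))       ≡⟨ cong (_∧ (y ≐ last s (even? n))) (sym (profile-at u s)) ⟩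
  profile u at s ∧ (y ≐ last s (even? n))           ∎
  where open ≡-Reasoning

-- Whether a ∷ (u ∷ʳ b) is special s, read off the profile of u and the parity e of its length.
encloses : Bool → Bool → Profile → Bool → Special → Bool
encloses a b P e s = P at dual s ∧ ((a ≐ first s) ∧ (b ≐ last (dual s) e))

==-special-enclosing : ∀ {n} a b (u : Vec Bool n) s →
  (a ∷ (u ∷ʳ b)) == special s (suc (suc n)) ≡ encloses a b (profile u) (even? n) s
==-special-enclosing {n} a b u s = begin
  (a ∷ (u ∷ʳ b)) == special s (suc (suc n))
    ≡⟨ cong ((a ∷ (u ∷ʳ b)) ==_) (special-enclose s n) ⟩
  (a ≐ first s) ∧ ((u ∷ʳ b) == (special (dual s) n ∷ʳ ℓ))
    ≡⟨ cong ((a ≐ first s) ∧_) (==-∷ʳ u (special (dual s) n) b ℓ) ⟩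
  (a ≐ first s) ∧ ((u == special (dual s) n) ∧ (b ≐ ℓ))
    ≡⟨ x∙yz≈y∙xz (a ≐ first s) (u == special (dual s) n) (b ≐ ℓ) ⟩
  (u == special (dual s) n) ∧ ((a ≐ first s) ∧ (b ≐ ℓ))
    ≡⟨ cong (_∧ ((a ≐ first s) ∧ (b ≐ ℓ))) (sym (profile-at u (dual s))) ⟩
  encloses a b (profile u) (even? n) s ∎
  where
  open ≡-Reasoning
  ℓ = last (dual s) (even? n)

-- The tests isTeven, isCTeven, isZeroOdd and isOneOdd applied to a ∷ (u ∷ʳ b) have this form, with g the
-- identity or not.
guarded-enclosing : ∀ {n} (g : Bool → Bool) a b (u : Vec Bool n) s →
  g (even? (suc (suc n))) ∧ ⌊ (a ∷ (u ∷ʳ b)) ≟v special s (suc (suc n)) ⌋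
    ≡ encloses a b (profile u) (even? n) s ∧ g (even? n)
guarded-enclosing {n} g a b u s = begin
  g (not (not (even? n))) ∧ ⌊ (a ∷ (u ∷ʳ b)) ≟v special s (suc (suc n)) ⌋
    ≡⟨ cong₂ _∧_ (cong g (Boolₚ.not-involutive (even? n)))
                 (trans (isYes≗does _) (==-special-enclosing a b u s)) ⟩
  g (even? n) ∧ encloses a b (profile u) (even? n) s
    ≡⟨ Boolₚ.∧-comm (g (even? n)) _ ⟩
  encloses a b (profile u) (even? n) s ∧ g (even? n) ∎
  where open ≡-Reasoning

override : Bool → ℤ → Bool → ℤ → ℤ → ℤ
override p x q y d = if p then x else if q then y else d

ξ-unfolded : Bool → Bool → Profile → Bool → ℤ → ℤ → ℤ
ξ-unfolded a b P e l r =
  override (encloses a b P e alt ∧ e) 1ℤ (encloses a b P e coalt ∧ e) -1ℤ (sgn (l ℤ.+ r))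

ξ-unfold : ∀ {n} a b (u : Vec Bool n) →
  ξ (a ∷ (u ∷ʳ b)) ≡ ξ-unfolded a b (profile u) (even? n) (ξ (a ∷ u)) (ξ (u ∷ʳ b))
ξ-unfold a b u = trans
  (cong (λ v → override (isTeven w) 1ℤ (isCTeven w) -1ℤ (sgn (ξ v ℤ.+ ξ (u ∷ʳ b))))
        (Vecₚ.init-∷ʳ b (a ∷ u)))
  (cong₂ (λ p q → override p 1ℤ q -1ℤ (sgn (ξ (a ∷ u) ℤ.+ ξ (u ∷ʳ b))))
         (guarded-enclosing (λ x → x) a b u alt) (guarded-enclosing (λ x → x) a b u coalt))
  where w = a ∷ (u ∷ʳ b)

φ-unfolded : Bool → Bool → Profile → Bool → ℤ → ℤ → ℤ
φ-unfolded a b P e l r =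
  override (encloses a b P e zeros ∧ not e) -1ℤ (encloses a b P e ones ∧ not e) 1ℤ (sgn (r - l))

φ-unfold : ∀ {n} a b (u : Vec Bool n) →
  φ (a ∷ (u ∷ʳ b)) ≡ φ-unfolded a b (profile u) (even? n) (φ (a ∷ u)) (φ (u ∷ʳ b))
φ-unfold a b u = trans
  (cong (λ v → override (isZeroOdd w) -1ℤ (isOneOdd w) 1ℤ (sgn (φ (u ∷ʳ b) - φ v)))
        (Vecₚ.init-∷ʳ b (a ∷ u)))
  (cong₂ (λ p q → override p -1ℤ q 1ℤ (sgn (φ (u ∷ʳ b) - φ (a ∷ u))))
         (guarded-enclosing not a b u zeros) (guarded-enclosing not a b u ones))
  where w = a ∷ (u ∷ʳ b)

data Shape {n} (u : Vec Bool n) : Set where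
  special-shape : ∀ s → u ≡ special s n → Shape u
  generic-shape : profile u ≡ generic → Shape u

shape : ∀ {n} (u : Vec Bool n) → Shape u
shape {n} u with u == special zeros n in z
... | true = special-shape zeros (==⇒≡ u _ z)
... | false with u == special ones n in o
...   | true = special-shape ones (==⇒≡ u _ o)
...   | false with u == special alt n in t
...     | true = special-shape alt (==⇒≡ u _ t)
...     | false with u == special coalt n in c
...       | true = special-shape coalt (==⇒≡ u _ c)
...       | false = generic-shape (tabulate-cong {g = λ s → u == special s n} {h = λ _ → false}
                                      λ { zeros → z ; ones → o ; alt → t ; coalt → c })

-- Peeling laws

module EndpointRecursion
  (f : ∀ {n} → Vec Bool n → ℤ)
  (unfolded : Bool → Bool → Profile → Bool → ℤ → ℤ → ℤ)
  (f-unfold : ∀ {n} a b (u : Vec Bool n) →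
              f (a ∷ (u ∷ʳ b)) ≡ unfolded a b (profile u) (even? n) (f (a ∷ u)) (f (u ∷ʳ b)))
  (peeled : Bool → Bool → Profile → Bool → ℤ → ℤ)
  (value : Special → Bool → ℤ)
  where

  PeelLaw : ℕ → Set
  PeelLaw n = ∀ a b (u : Vec Bool n) → f (a ∷ (u ∷ʳ b)) ≡ peeled a b (profile u) (even? n) (f u)

  SmallPeelLaws : Set
  SmallPeelLaws = PeelLaw 0 × PeelLaw 1 × PeelLaw 2 × PeelLaw 3 × PeelLaw 4

  small-peel-laws? : Dec SmallPeelLaws
  small-peel-laws? = law? 0 ×-dec law? 1 ×-dec law? 2 ×-dec law? 3 ×-dec law? 4
    where
    law? : ∀ n → Dec (PeelLaw n)
    law? n = ∀?-Bool λ a → ∀?-Bool λ b → ∀?-Vec n λ u →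
      f (a ∷ (u ∷ʳ b)) ℤₚ.≟ peeled a b (profile u) (even? n) (f u)

  Values : ℕ → Set
  Values n = ∀ s → f (special s n) ≡ value s (even? n)

  SmallValues : Set
  SmallValues = Values 1 × Values 2 × Values 3

  small-values? : Dec SmallValues
  small-values? = values? 1 ×-dec values? 2 ×-dec values? 3
    where
    values? : ∀ n → Dec (Values n)
    values? n = ∀?-Special λ s → f (special s n) ℤₚ.≟ value s (even? n)

  ValueCoherence : Set
  ValueCoherence = ∀ s e →
    unfolded (first s) (last (dual s) e) (profileOf (dual s)) e (value s (not e)) (value (dual s) (not e))
      ≡ value s (not (not e))

  value-coherence? : Dec ValueCoherence
  value-coherence? = ∀?-Special λ s → ∀?-Bool λ e → _ ℤₚ.≟ _

  values : SmallValues → ValueCoherence → ∀ n → Values (suc n)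
  values (v₁ , v₂ , v₃) coh = go
    where
    go : ∀ n → Values (suc n)
    go 0 = v₁
    go 1 = v₂
    go 2 = v₃
    go (suc (suc (suc n))) s = begin
      f (special s (4 + n))
        ≡⟨ cong f (special-enclose s (2 + n)) ⟩
      f (first s ∷ (special (dual s) (2 + n) ∷ʳ ℓ))
        ≡⟨ f-unfold (first s) ℓ (special (dual s) (2 + n)) ⟩
      unfolded (first s) ℓ (profile (special (dual s) (2 + n))) e
        (f (first s ∷ special (dual s) (2 + n))) (f (special (dual s) (2 + n) ∷ʳ ℓ))
        ≡⟨ cong₂ (λ P l → unfolded (first s) ℓ P e l (f (special (dual s) (2 + n) ∷ʳ ℓ))) (profile-special (dual s) n)
                 (trans (cong f (sym (special-suc s (2 + n)))) (go (suc (suc n)) s)) ⟩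
      unfolded (first s) ℓ (profileOf (dual s)) e (value s (not e)) (f (special (dual s) (2 + n) ∷ʳ ℓ))
        ≡⟨ cong (unfolded (first s) ℓ (profileOf (dual s)) e (value s (not e)))
                (trans (cong f (sym (special-∷ʳ (dual s) (2 + n)))) (go (suc (suc n)) (dual s))) ⟩
      unfolded (first s) ℓ (profileOf (dual s)) e (value s (not e)) (value (dual s) (not e))
        ≡⟨ coh s e ⟩
      value s (not (not e)) ∎
      where
      open ≡-Reasoning
      e = even? (2 + n)
      ℓ = last (dual s) e

  -- Writing u = x ∷ (m ∷ʳ y), both sides of the peel law for a ∷ (u ∷ʳ b) are determined by f (x ∷ m) and
  -- f (m ∷ʳ y), via the peel law one length down; coherence is the resulting identity.
  Coherent : Bool → Profile → (Bool → ℤ) → (Bool → ℤ) → Set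
  Coherent e P X₁ X₂ = ∀ a b x y →
    unfolded a b (cons x (snoc y e P)) (not (not e))
      (peeled a y (cons x P) (not e) (X₁ x)) (peeled x b (snoc y e P) (not e) (X₂ y))
    ≡ peeled a b (cons x (snoc y e P)) (not (not e)) (unfolded x y P e (X₁ x) (X₂ y))

  peel-step : ∀ {k} → PeelLaw (suc k) →
    ((m : Vec Bool k) → Coherent (even? k) (profile m) (λ x → f (x ∷ m)) (λ y → f (m ∷ʳ y))) →
    PeelLaw (suc (suc k))
  peel-step {k} law coh a b w with enclosed? w
  ... | enclosed x m y = begin
    f (a ∷ ((x ∷ (m ∷ʳ y)) ∷ʳ b))
      ≡⟨ f-unfold a b (x ∷ (m ∷ʳ y)) ⟩
    unfolded a b (profile (x ∷ (m ∷ʳ y))) e″ (f (a ∷ ((x ∷ m) ∷ʳ y))) (f (x ∷ ((m ∷ʳ y) ∷ʳ b)))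
      ≡⟨ cong₂ (λ P l → unfolded a b P e″ l (f (x ∷ ((m ∷ʳ y) ∷ʳ b)))) Q-eq left ⟩
    unfolded a b Q e″ (peeled a y (cons x P) e′ (f (x ∷ m))) (f (x ∷ ((m ∷ʳ y) ∷ʳ b)))
      ≡⟨ cong (unfolded a b Q e″ (peeled a y (cons x P) e′ (f (x ∷ m)))) right ⟩
    unfolded a b Q e″ (peeled a y (cons x P) e′ (f (x ∷ m))) (peeled x b (snoc y e P) e′ (f (m ∷ʳ y)))
      ≡⟨ coh m a b x y ⟩
    peeled a b Q e″ (unfolded x y P e (f (x ∷ m)) (f (m ∷ʳ y)))
      ≡⟨ cong₂ (λ P d → peeled a b P e″ d) (sym Q-eq) (sym (f-unfold x y m)) ⟩
    peeled a b (profile (x ∷ (m ∷ʳ y))) e″ (f (x ∷ (m ∷ʳ y))) ∎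
    where
    open ≡-Reasoning
    e = even? k
    e′ = not e
    e″ = not e′
    P = profile m
    Q = cons x (snoc y e P)
    Q-eq : profile (x ∷ (m ∷ʳ y)) ≡ Q
    Q-eq = trans (profile-∷ x (m ∷ʳ y)) (cong (cons x) (profile-∷ʳ m y))
    left : f (a ∷ ((x ∷ m) ∷ʳ y)) ≡ peeled a y (cons x P) e′ (f (x ∷ m))
    left = trans (law a y (x ∷ m)) (cong (λ P → peeled a y P e′ (f (x ∷ m))) (profile-∷ x m))
    right : f (x ∷ ((m ∷ʳ y) ∷ʳ b)) ≡ peeled x b (snoc y e P) e′ (f (m ∷ʳ y))
    right = trans (law x b (m ∷ʳ y)) (cong (λ P → peeled x b P e′ (f (m ∷ʳ y))) (profile-∷ʳ m y))

  coherent-cong : ∀ {e P P′} {X₁ X₁′ X₂ X₂′ : Bool → ℤ} → P ≡ P′ →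
    (∀ x → X₁ x ≡ X₁′ x) → (∀ y → X₂ y ≡ X₂′ y) → Coherent e P′ X₁′ X₂′ → Coherent e P X₁ X₂
  coherent-cong refl eq₁ eq₂ coh a b x y rewrite eq₁ x | eq₂ y = coh a b x y

  -- For m = special s (suc n), one peeling step down to special strings of length n gives f (x ∷ m) and
  -- f (m ∷ʳ y).
  SpecialCoherence : Set
  SpecialCoherence = ∀ s e → Coherent (not e) (profileOf s)
    (λ x → peeled x (last s e) (profileOf s) e (value s e))
    (λ y → peeled (first s) y (profileOf (dual s)) e (value (dual s) e))

  special-coherence? : Dec SpecialCoherence
  special-coherence? = ∀?-Special λ s → ∀?-Bool λ e →
    ∀?-Bool λ a → ∀?-Bool λ b → ∀?-Bool λ x → ∀?-Bool λ y → _ ℤₚ.≟ _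

  GenericCoherence : Set
  GenericCoherence = ∀ e X₁ X₂ → Coherent e generic X₁ X₂

  coherent : (∀ n → Values (suc n)) → SpecialCoherence → GenericCoherence →
    ∀ {j} → PeelLaw (2 + j) → (m : Vec Bool (3 + j)) →
    Coherent (even? (3 + j)) (profile m) (λ x → f (x ∷ m)) (λ y → f (m ∷ʳ y))
  coherent vals sc gc {j} law m with shape m
  ... | generic-shape eq = coherent-cong eq (λ _ → refl) (λ _ → refl) (gc _ _ _)
  ... | special-shape s refl = coherent-cong (profile-special s (suc j)) left right (sc s e)
    where
    open ≡-Reasoning
    e = even? (2 + j)
    left : ∀ x → f (x ∷ special s (3 + j)) ≡ peeled x (last s e) (profileOf s) e (value s e)
    left x = begin
      f (x ∷ special s (3 + j))
        ≡⟨ cong (λ v → f (x ∷ v)) (special-∷ʳ s (2 + j)) ⟩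
      f (x ∷ (special s (2 + j) ∷ʳ last s e))
        ≡⟨ law x (last s e) (special s (2 + j)) ⟩
      peeled x (last s e) (profile (special s (2 + j))) e (f (special s (2 + j)))
        ≡⟨ cong₂ (λ P d → peeled x (last s e) P e d) (profile-special s j) (vals (suc j) s) ⟩
      peeled x (last s e) (profileOf s) e (value s e) ∎
    right : ∀ y → f (special s (3 + j) ∷ʳ y) ≡ peeled (first s) y (profileOf (dual s)) e (value (dual s) e)
    right y = begin
      f (special s (3 + j) ∷ʳ y)
        ≡⟨ cong (λ v → f (v ∷ʳ y)) (special-suc s (2 + j)) ⟩
      f (first s ∷ (special (dual s) (2 + j) ∷ʳ y))
        ≡⟨ law (first s) y (special (dual s) (2 + j)) ⟩
      peeled (first s) y (profile (special (dual s) (2 + j))) e (f (special (dual s) (2 + j)))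
        ≡⟨ cong₂ (λ P d → peeled (first s) y P e d) (profile-special (dual s) j) (vals (suc j) (dual s)) ⟩
      peeled (first s) y (profileOf (dual s)) e (value (dual s) e) ∎

  peel-law : (∀ n → Values (suc n)) → SpecialCoherence → GenericCoherence → SmallPeelLaws →
    ∀ n → PeelLaw n
  peel-law vals sc gc (p₀ , p₁ , p₂ , p₃ , p₄) = go
    where
    go : ∀ n → PeelLaw n
    go 0 = p₀
    go 1 = p₁
    go 2 = p₂
    go 3 = p₃
    go 4 = p₄
    go (suc (suc (suc (suc (suc j))))) =
      peel-step (go (suc (suc (suc (suc j))))) (coherent vals sc gc (go (suc (suc j))))

σ : Bool → ℤ
σ b = if b then 1ℤ else -1ℤ

ξ-stops : Bool → Bool → Profile → Bool → Bool
ξ-stops a b ⟨ z , o , t , c ⟩ e =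
  (z ∨ o) ∧ (a xor b) ∨ c ∧ (not a ∧ b ∨ a ∧ not b ∧ not e) ∨ t ∧ (a ∧ not b ∨ not a ∧ b ∧ not e)

ξ-peeled : Bool → Bool → Profile → Bool → ℤ → ℤ
ξ-peeled a b P e d = if ξ-stops a b P e then σ b else d

ξ-value : Special → Bool → ℤ
ξ-value zeros e = 0ℤ
ξ-value ones  e = 0ℤ
ξ-value alt   e = if e then 1ℤ else 0ℤ
ξ-value coalt e = if e then -1ℤ else 0ℤ

module Ξ = EndpointRecursion ξ ξ-unfolded ξ-unfold ξ-peeled ξ-value

ξ-values : ∀ n → Ξ.Values (suc n)
ξ-values = Ξ.values (from-yes Ξ.small-values?) (from-yes Ξ.value-coherence?)

-- With no special string around, neither the defining tests nor peeling ever stop: both sides reduce to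
-- sgn (X₁ x + X₂ y).
ξ-generic-coherence : Ξ.GenericCoherence
ξ-generic-coherence _ _ _ _ _ _ _ = refl

ξ-peel : ∀ n → Ξ.PeelLaw n
ξ-peel = Ξ.peel-law ξ-values (from-yes Ξ.special-coherence?) ξ-generic-coherence
  (from-yes Ξ.small-peel-laws?)

φ-stops : Bool → Bool → Profile → Bool → Bool
φ-stops a b ⟨ z , o , _ , _ ⟩ e =
  z ∧ not e ∧ not a ∧ not b ∨ o ∧ not e ∧ a ∧ b ∨ (z ∨ o) ∧ e ∧ (a xor b)

φ-peeled : Bool → Bool → Profile → Bool → ℤ → ℤ
φ-peeled a b P e d = if φ-stops a b P e then σ b else ℤ.- d

φ-value : Special → Bool → ℤ
φ-value zeros e = if e then 0ℤ else -1ℤ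
φ-value ones  e = if e then 0ℤ else 1ℤ
φ-value alt   e = if e then 1ℤ else -1ℤ
φ-value coalt e = if e then -1ℤ else 1ℤ

sgn-neg : ∀ i → sgn (ℤ.- i) ≡ ℤ.- sgn i
sgn-neg (+ zero) = refl
sgn-neg (+ suc _) = refl
sgn-neg ℤ.-[1+ _ ] = refl

sgn-neg-difference : ∀ i j → sgn (ℤ.- j - ℤ.- i) ≡ ℤ.- sgn (j - i)
sgn-neg-difference i j =
  trans (cong sgn (sym (ℤₚ.neg-distrib-+ j (ℤ.- i)))) (sgn-neg (j - i))

module Φ = EndpointRecursion φ φ-unfolded φ-unfold φ-peeled φ-value

φ-values : ∀ n → Φ.Values (suc n)
φ-values = Φ.values (from-yes Φ.small-values?) (from-yes Φ.value-coherence?)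

φ-generic-coherence : Φ.GenericCoherence
φ-generic-coherence _ X₁ X₂ _ _ x y = sgn-neg-difference (X₁ x) (X₂ y)

φ-peel : ∀ n → Φ.PeelLaw n
φ-peel = Φ.peel-law φ-values (from-yes Φ.special-coherence?) φ-generic-coherence
  (from-yes Φ.small-peel-laws?)

-- Zeros of ψ

φ-peeled≡0 : ∀ a b P e d → φ-peeled a b P e d ≡ 0ℤ → φ-stops a b P e ≡ false × d ≡ 0ℤ
φ-peeled≡0 a b P e d eq with φ-stops a b P e
φ-peeled≡0 a false P e d () | true
φ-peeled≡0 a true  P e d () | true
... | false = refl , trans (sym (ℤₚ.neg-involutive d)) (cong ℤ.-_ eq)

ZeroTransfer : ℕ → Set
ZeroTransfer n = (v : Vec Bool n) → φ v ≡ 0ℤ → ξ v ≡ 0ℤ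

zero-transfer? : ∀ n → Dec (ZeroTransfer n)
zero-transfer? n = ∀?-Vec n λ v → (φ v ℤₚ.≟ 0ℤ) →-dec (ξ v ℤₚ.≟ 0ℤ)

SpecialStopsTransfer : Set
SpecialStopsTransfer = ∀ s e a b →
  φ-stops a b (profileOf s) e ≡ false → φ-value s e ≡ 0ℤ → ξ-stops a b (profileOf s) e ≡ false

special-stops-transfer : SpecialStopsTransfer
special-stops-transfer = from-yes (∀?-Special λ s → ∀?-Bool λ e → ∀?-Bool λ a → ∀?-Bool λ b →
  (φ-stops a b (profileOf s) e Boolₚ.≟ false) →-dec (φ-value s e ℤₚ.≟ 0ℤ) →-dec
  (ξ-stops a b (profileOf s) e Boolₚ.≟ false))

stops-transfer : ∀ {k} a b (u : Vec Bool (2 + k)) → let e = even? (2 + k) in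
  φ-stops a b (profile u) e ≡ false → φ u ≡ 0ℤ → ξ-stops a b (profile u) e ≡ false
stops-transfer {k} a b u with shape u
... | generic-shape eq = λ _ _ → cong (λ P → ξ-stops a b P (even? (2 + k))) eq
... | special-shape s refl = λ φ-continues φu≡0 → begin
  ξ-stops a b (profile (special s (2 + k))) e ≡⟨ cong (λ P → ξ-stops a b P e) (profile-special s k) ⟩
  ξ-stops a b (profileOf s) e                 ≡⟨ special-stops-transfer s e a b
                                                   (trans (cong (λ P → φ-stops a b P e) (sym P≡)) φ-continues)
                                                   (trans (sym (φ-values (suc k) s)) φu≡0) ⟩
  false                                       ∎
  where
  open ≡-Reasoning
  e = even? (2 + k)
  P≡ = profile-special s k

zero-transfer-step : ∀ {k} → ZeroTransfer (2 + k) → ZeroTransfer (4 + k)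
zero-transfer-step {k} transfer w φ≡0 with enclosed? w
... | enclosed a u b = begin
  ξ (a ∷ (u ∷ʳ b))               ≡⟨ ξ-peel (2 + k) a b u ⟩
  ξ-peeled a b P e (ξ u)         ≡⟨ cong (ξ-peeled a b P e) (transfer u (proj₂ φ-inner)) ⟩
  ξ-peeled a b P e 0ℤ            ≡⟨ cong (λ p → if p then σ b else 0ℤ)
                                         (stops-transfer a b u (proj₁ φ-inner) (proj₂ φ-inner)) ⟩
  0ℤ                             ∎
  where
  open ≡-Reasoning
  P = profile u
  e = even? (2 + k)
  φ-inner : φ-stops a b P e ≡ false × φ u ≡ 0ℤ
  φ-inner = φ-peeled≡0 a b P e (φ u) (trans (sym (φ-peel (2 + k) a b u)) φ≡0)

φ-zero⇒ξ-zero : ∀ n → ZeroTransfer n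
φ-zero⇒ξ-zero 0 = from-yes (zero-transfer? 0)
φ-zero⇒ξ-zero 1 = from-yes (zero-transfer? 1)
φ-zero⇒ξ-zero 2 = from-yes (zero-transfer? 2)
φ-zero⇒ξ-zero 3 = from-yes (zero-transfer? 3)
φ-zero⇒ξ-zero (suc (suc (suc (suc k)))) = zero-transfer-step (φ-zero⇒ξ-zero (suc (suc k)))

ψ≡0⇒ξ≡0 : ∀ {n} (v : Vec Bool n) → ψ v ≡ 0ℤ → ξ v ≡ 0ℤ
ψ≡0⇒ξ≡0 {zero} [] _ = refl
ψ≡0⇒ξ≡0 {suc n} v ψ≡0 =
  [ ℤₚ.i^n≡0⇒i≡0 (ξ v) (suc n) , φ-zero⇒ξ-zero (suc n) v ]′
    (ℤₚ.i*j≡0⇒i≡0∨j≡0 (ξ v ℤ.^ suc n) ψ≡0)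

ξ≡0⇒ψ≡0 : ∀ {n} (v : Vec Bool n) → ξ v ≡ 0ℤ → ψ v ≡ 0ℤ
ξ≡0⇒ψ≡0 {zero} [] _ = refl
ξ≡0⇒ψ≡0 {suc n} v ξ≡0 rewrite ξ≡0 = refl

-- Counting

∑-Bool : (Bool → ℕ) → ℕ
∑-Bool g = g false + g true

∑-Vec : ∀ n → (Vec Bool n → ℕ) → ℕ
∑-Vec zero    g = g []
∑-Vec (suc n) g = ∑-Bool λ x → ∑-Vec n (λ u → g (x ∷ u))

∑-Special : (Special → ℕ) → ℕ
∑-Special g = g zeros + (g ones + (g alt + g coalt))

∑-Bool-cong : {g h : Bool → ℕ} → (∀ x → g x ≡ h x) → ∑-Bool g ≡ ∑-Bool h
∑-Bool-cong g≗h = cong₂ _+_ (g≗h false) (g≗h true)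

∑-Special-cong : {g h : Special → ℕ} → (∀ s → g s ≡ h s) → ∑-Special g ≡ ∑-Special h
∑-Special-cong g≗h = cong₂ _+_ (g≗h zeros) (cong₂ _+_ (g≗h ones) (cong₂ _+_ (g≗h alt) (g≗h coalt)))

∑-Bool-+ : ∀ (g h : Bool → ℕ) → ∑-Bool (λ x → g x + h x) ≡ ∑-Bool g + ∑-Bool h
∑-Bool-+ g h = +-interchange (g false) (h false) (g true) (h true)

∑-Vec-cong : ∀ n {g h : Vec Bool n → ℕ} → (∀ u → g u ≡ h u) → ∑-Vec n g ≡ ∑-Vec n h
∑-Vec-cong zero    g≗h = g≗h []
∑-Vec-cong (suc n) g≗h = ∑-Bool-cong λ x → ∑-Vec-cong n (λ u → g≗h (x ∷ u))

∑-Vec-+ : ∀ n (g h : Vec Bool n → ℕ) → ∑-Vec n (λ u → g u + h u) ≡ ∑-Vec n g + ∑-Vec n h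
∑-Vec-+ zero    g h = refl
∑-Vec-+ (suc n) g h = trans
  (cong₂ _+_ (∑-Vec-+ n (λ u → g (false ∷ u)) (λ u → h (false ∷ u)))
             (∑-Vec-+ n (λ u → g (true ∷ u)) (λ u → h (true ∷ u))))
  (∑-Bool-+ (λ x → ∑-Vec n (λ u → g (x ∷ u))) (λ x → ∑-Vec n (λ u → h (x ∷ u))))

∑-Vec-zero : ∀ n → ∑-Vec n (λ _ → 0) ≡ 0
∑-Vec-zero zero    = refl
∑-Vec-zero (suc n) = cong₂ _+_ (∑-Vec-zero n) (∑-Vec-zero n)

∑-Vec-point : ∀ {n} (s : Vec Bool n) c → ∑-Vec n (λ u → if u == s then c else 0) ≡ c
∑-Vec-point [] c = refl
∑-Vec-point {suc n} (false ∷ s) c =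
  trans (cong₂ _+_ (∑-Vec-point s c) (∑-Vec-zero n)) (ℕₚ.+-identityʳ c)
∑-Vec-point {suc n} (true ∷ s) c = cong₂ _+_ (∑-Vec-zero n) (∑-Vec-point s c)

∑-Vec-∷ʳ : ∀ n (g : Vec Bool (suc n) → ℕ) → ∑-Vec (suc n) g ≡ ∑-Bool λ b → ∑-Vec n (λ u → g (u ∷ʳ b))
∑-Vec-∷ʳ zero    g = refl
∑-Vec-∷ʳ (suc n) g = trans
  (cong₂ _+_ (∑-Vec-∷ʳ n (λ u → g (false ∷ u))) (∑-Vec-∷ʳ n (λ u → g (true ∷ u))))
  (sym (∑-Bool-+ (λ b → ∑-Vec n (λ u → g (false ∷ (u ∷ʳ b)))) (λ b → ∑-Vec n (λ u → g (true ∷ (u ∷ʳ b))))))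

∑-Vec-enclosed : ∀ n (g : Vec Bool (suc (suc n)) → ℕ) →
  ∑-Vec (suc (suc n)) g ≡ ∑-Bool λ a → ∑-Bool λ b → ∑-Vec n (λ u → g (a ∷ (u ∷ʳ b)))
∑-Vec-enclosed n g = cong₂ _+_ (∑-Vec-∷ʳ n (λ u → g (false ∷ u))) (∑-Vec-∷ʳ n (λ u → g (true ∷ u)))

∑-Vec-∑-Special : ∀ n (h : Vec Bool n → Special → ℕ) →
  ∑-Vec n (λ u → ∑-Special (h u)) ≡ ∑-Special (λ s → ∑-Vec n (λ u → h u s))
∑-Vec-∑-Special n h = begin
  ∑-Vec n (λ u → h u zeros + (h u ones + (h u alt + h u coalt)))
    ≡⟨ ∑-Vec-+ n (λ u → h u zeros) _ ⟩
  ∑-Vec n (λ u → h u zeros) + ∑-Vec n (λ u → h u ones + (h u alt + h u coalt))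
    ≡⟨ cong (λ x → ∑-Vec n (λ u → h u zeros) + x) (∑-Vec-+ n (λ u → h u ones) _) ⟩
  ∑-Vec n (λ u → h u zeros) + (∑-Vec n (λ u → h u ones) + ∑-Vec n (λ u → h u alt + h u coalt))
    ≡⟨ cong (λ x → ∑-Vec n (λ u → h u zeros) + (∑-Vec n (λ u → h u ones) + x))
            (∑-Vec-+ n (λ u → h u alt) (λ u → h u coalt)) ⟩
  ∑-Special (λ s → ∑-Vec n (λ u → h u s)) ∎
  where open ≡-Reasoning

∑-Special-point : ∀ t (h : Special → ℕ) → ∑-Special (λ s → if profileOf t at s then h s else 0) ≡ h t
∑-Special-point zeros h = ℕₚ.+-identityʳ (h zeros)
∑-Special-point ones  h = ℕₚ.+-identityʳ (h ones)
∑-Special-point alt   h = ℕₚ.+-identityʳ (h alt)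
∑-Special-point coalt h = refl

∑-Vec-special : ∀ n (g : Vec Bool (suc (suc n)) → ℕ) → (∀ u → profile u ≡ generic → g u ≡ 0) →
  ∑-Vec (suc (suc n)) g ≡ ∑-Special (λ s → g (special s (suc (suc n))))
∑-Vec-special n g vanishes = begin
  ∑-Vec N g                                   ≡⟨ ∑-Vec-cong N split ⟩
  ∑-Vec N (λ u → ∑-Special (λ s → δ s u))     ≡⟨ ∑-Vec-∑-Special N (λ u s → δ s u) ⟩
  ∑-Special (λ s → ∑-Vec N (δ s))             ≡⟨ ∑-Special-cong point ⟩
  ∑-Special (λ s → g (special s N))           ∎
  where
  open ≡-Reasoning
  N = suc (suc n)
  δ : Special → Vec Bool N → ℕ
  δ s u = if u == special s N then g (special s N) else 0
  point : ∀ s → ∑-Vec N (δ s) ≡ g (special s N)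
  point s = ∑-Vec-point (special s N) (g (special s N))
  split : ∀ u → g u ≡ ∑-Special (λ s → δ s u)
  split u with shape u
  ... | generic-shape eq = trans (vanishes u eq) (sym (∑-Special-cong off))
    where
    off : ∀ s → δ s u ≡ 0
    off s = cong (λ p → if p then g (special s N) else 0)
      (trans (sym (profile-at u s)) (trans (cong (_at s) eq) (generic-at s)))
  ... | special-shape t refl = sym (begin
    ∑-Special (λ s → δ s (special t N))
      ≡⟨ ∑-Special-cong on ⟩
    ∑-Special (λ s → if profileOf t at s then g (special s N) else 0)
      ≡⟨ ∑-Special-point t (λ s → g (special s N)) ⟩
    g (special t N) ∎)
    where
    on : ∀ s → δ s (special t N) ≡ (if profileOf t at s then g (special s N) else 0)
    on s = cong (λ p → if p then g (special s N) else 0)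
      (trans (sym (profile-at (special t N) s)) (cong (_at s) (profile-special t n)))

χ : Bool → ℕ
χ b = if b then 1 else 0

count : ∀ n → (Vec Bool n → Bool) → ℕ
count n p = ∑-Vec n (λ u → χ (p u))

count-split : ∀ n (q p : Vec Bool n → Bool) →
  count n (λ u → not (q u) ∧ p u) + count n (λ u → q u ∧ p u) ≡ count n p
count-split n q p = trans (sym (∑-Vec-+ n _ _)) (∑-Vec-cong n split)
  where
  split : ∀ u → χ (not (q u) ∧ p u) + χ (q u ∧ p u) ≡ χ (p u)
  split u with q u
  ... | true  = refl
  ... | false = ℕₚ.+-identityʳ _

length-filter-map : ∀ {n} {P : Vec Bool (suc n) → Set} (P? : Decidable P) x (us : List (Vec Bool n)) →
  length (filter P? (List.map (x ∷_) us)) ≡ length (filter (λ u → P? (x ∷ u)) us)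
length-filter-map P? x [] = refl
length-filter-map P? x (u ∷ us) with does (P? (x ∷ u))
... | true  = cong suc (length-filter-map P? x us)
... | false = length-filter-map P? x us

length-filter-allStrings : ∀ n {P : Vec Bool n → Set} (P? : Decidable P) →
  length (filter P? (allStrings n)) ≡ count n (λ u → does (P? u))
length-filter-allStrings zero P? with does (P? [])
... | true  = refl
... | false = refl
length-filter-allStrings (suc n) P? = begin
  length (filter P? (List.map (false ∷_) us ++ List.map (true ∷_) us))
    ≡⟨ cong length (Listₚ.filter-++ P? (List.map (false ∷_) us) _) ⟩
  length (filter P? (List.map (false ∷_) us) ++ filter P? (List.map (true ∷_) us))
    ≡⟨ Listₚ.length-++ (filter P? (List.map (false ∷_) us)) ⟩
  length (filter P? (List.map (false ∷_) us)) + length (filter P? (List.map (true ∷_) us))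
    ≡⟨ cong₂ _+_ (trans (length-filter-map P? false us) (length-filter-allStrings n _))
                 (trans (length-filter-map P? true us) (length-filter-allStrings n _)) ⟩
  count (suc n) (λ u → does (P? u)) ∎
  where
  open ≡-Reasoning
  us = allStrings n

does-⇔ : ∀ {A B : Set} (a? : Dec A) (b? : Dec B) → (A → B) → (B → A) → does a? ≡ does b?
does-⇔ a? b? f g with a?
... | yes a = sym (dec-true b? (f a))
... | no ¬a = sym (dec-false b? (λ b → ¬a (g b)))

zero? : ℤ → Bool
zero? i = does (i ℤₚ.≟ 0ℤ)

K-count : ∀ n → K n ≡ count n (λ u → zero? (ξ u))
K-count n = trans (length-filter-allStrings n (λ w → ψ w ℤₚ.≟ 0ℤ))
  (∑-Vec-cong n λ u → cong χ
    (does-⇔ (ψ u ℤₚ.≟ 0ℤ) (ξ u ℤₚ.≟ 0ℤ) (ψ≡0⇒ξ≡0 u) (ξ≡0⇒ψ≡0 u)))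

zero?-ξ-peeled : ∀ a b P e d → zero? (ξ-peeled a b P e d) ≡ not (ξ-stops a b P e) ∧ zero? d
zero?-ξ-peeled a b P e d with ξ-stops a b P e
zero?-ξ-peeled a false P e d | true = refl
zero?-ξ-peeled a true  P e d | true = refl
... | false = refl

-- The strings u with ξ u = 0 for which ξ (a ∷ (u ∷ʳ b)) ≠ 0, summed over the enclosing letters a, b.
defect : ℕ → ℕ
defect N = ∑-Bool λ a → ∑-Bool λ b → count N (λ u → ξ-stops a b (profile u) (even? N) ∧ zero? (ξ u))

K-enclosed : ∀ N → K (2 + N) + defect N ≡ 4 ℕ.* K N
K-enclosed N = begin
  K (2 + N) + defect N
    ≡⟨ cong (λ k → k + defect N) (trans (K-count (2 + N)) (∑-Vec-enclosed N (λ w → χ (zero? (ξ w))))) ⟩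
  ∑-Bool (λ a → ∑-Bool (vanishing a)) + ∑-Bool (λ a → ∑-Bool (stopping a))
    ≡⟨ sym (∑-Bool-+ (λ a → ∑-Bool (vanishing a)) (λ a → ∑-Bool (stopping a))) ⟩
  ∑-Bool (λ a → ∑-Bool (vanishing a) + ∑-Bool (stopping a))
    ≡⟨ ∑-Bool-cong (λ a → sym (∑-Bool-+ (vanishing a) (stopping a))) ⟩
  ∑-Bool (λ a → ∑-Bool λ b → vanishing a b + stopping a b)
    ≡⟨ ∑-Bool-cong (λ a → ∑-Bool-cong (λ b → enclosed-split a b)) ⟩
  ∑-Bool (λ _ → ∑-Bool λ _ → K N)
    ≡⟨ four-copies (K N) ⟩
  4 ℕ.* K N ∎
  where
  open ≡-Reasoning
  four-copies : ∀ k → (k + k) + (k + k) ≡ 4 ℕ.* k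
  four-copies = solve-∀
  stops : Bool → Bool → Vec Bool N → Bool
  stops a b u = ξ-stops a b (profile u) (even? N)
  vanishing stopping : Bool → Bool → ℕ
  vanishing a b = count N (λ u → zero? (ξ (a ∷ (u ∷ʳ b))))
  stopping a b = count N (λ u → stops a b u ∧ zero? (ξ u))
  enclosed-split : ∀ a b → vanishing a b + stopping a b ≡ K N
  enclosed-split a b = begin
    vanishing a b + stopping a b
      ≡⟨ cong (λ k → k + stopping a b) (∑-Vec-cong N λ u → cong χ
           (trans (cong zero? (ξ-peel N a b u)) (zero?-ξ-peeled a b (profile u) (even? N) (ξ u)))) ⟩
    count N (λ u → not (stops a b u) ∧ zero? (ξ u)) + stopping a b
      ≡⟨ count-split N (stops a b) (λ u → zero? (ξ u)) ⟩
    count N (λ u → zero? (ξ u))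
      ≡⟨ sym (K-count N) ⟩
    K N ∎

special-defect : Bool → ℕ
special-defect e = ∑-Bool λ a → ∑-Bool λ b → ∑-Special λ s →
  χ (ξ-stops a b (profileOf s) e ∧ zero? (ξ-value s e))

defect-special : ∀ n → defect (2 + n) ≡ special-defect (even? (2 + n))
defect-special n = ∑-Bool-cong λ a → ∑-Bool-cong λ b →
  trans (∑-Vec-special n (λ u → χ (ξ-stops a b (profile u) e ∧ zero? (ξ u)))
                          (λ u eq → cong (λ P → χ (ξ-stops a b P e ∧ zero? (ξ u))) eq))
        (∑-Special-cong λ s → cong₂ (λ P v → χ (ξ-stops a b P e ∧ zero? v))
                                    (profile-special s n) (ξ-values (suc n) s))
  where e = even? (2 + n)

defect-periodic : ∀ n → defect (4 + n) ≡ defect (2 + n)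
defect-periodic n = begin
  defect (4 + n)                                   ≡⟨ defect-special (2 + n) ⟩
  special-defect (not (not (even? (2 + n))))       ≡⟨ cong special-defect (Boolₚ.not-involutive (even? (2 + n))) ⟩
  special-defect (even? (2 + n))                   ≡⟨ sym (defect-special n) ⟩
  defect (2 + n)                                   ∎
  where open ≡-Reasoning

K-recurrence : ∀ n → K (6 + n) + 4 ℕ.* K (2 + n) ≡ 5 ℕ.* K (4 + n)
K-recurrence n = begin
  K (6 + n) + 4 ℕ.* K (2 + n)              ≡⟨ cong (λ k → K (6 + n) + k) (sym (K-enclosed (2 + n))) ⟩
  K (6 + n) + (K (4 + n) + defect (2 + n)) ≡⟨ +-pull-right (K (6 + n)) (K (4 + n)) (defect (2 + n)) ⟩
  K (6 + n) + defect (2 + n) + K (4 + n)   ≡⟨ cong (λ d → K (6 + n) + d + K (4 + n)) (sym (defect-periodic n)) ⟩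
  K (6 + n) + defect (4 + n) + K (4 + n)   ≡⟨ cong (λ k → k + K (4 + n)) (K-enclosed (4 + n)) ⟩
  4 ℕ.* K (4 + n) + K (4 + n)              ≡⟨ ℕₚ.+-comm (4 ℕ.* K (4 + n)) (K (4 + n)) ⟩
  5 ℕ.* K (4 + n)                          ∎
  where open ≡-Reasoning

m+n≡o⇒m≡o-n : ∀ {a b c} → a + b ≡ c → + a ≡ + c - + b
m+n≡o⇒m≡o-n {a} {b} {c} a+b≡c = sym (begin
  + c - + b            ≡⟨ ℤₚ.m-n≡m⊖n c b ⟩
  c ⊖ b                ≡⟨ cong₂ _⊖_ (trans (sym a+b≡c) (ℕₚ.+-comm a b)) (sym (ℕₚ.+-identityʳ b)) ⟩
  (b + a) ⊖ (b + 0)    ≡⟨ ℤₚ.+-cancelˡ-⊖ b a 0 ⟩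
  + a                  ∎)
  where open ≡-Reasoning

corollary6p10 : (n : ℕ) → 2 ≤ n →
    + K (n + 4) ≡ (+ 5) * (+ K (n + 2)) - (+ 4) * (+ K n)
corollary6p10 (suc (suc m)) (s≤s (s≤s z≤n)) = begin
  + K (2 + (m + 4))                          ≡⟨ cong (λ k → + K (2 + k)) (ℕₚ.+-comm m 4) ⟩
  + K (6 + m)                                ≡⟨ m+n≡o⇒m≡o-n (K-recurrence m) ⟩
  + (5 ℕ.* K (4 + m)) - + (4 ℕ.* K (2 + m))  ≡⟨ cong₂ _-_ (ℤₚ.pos-* 5 (K (4 + m))) (ℤₚ.pos-* 4 (K (2 + m))) ⟩
  + 5 * + K (4 + m) - + 4 * + K (2 + m)      ≡⟨ cong (λ k → + 5 * + K (2 + k) - + 4 * + K (2 + m)) (ℕₚ.+-comm 2 m) ⟩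
  + 5 * + K (2 + (m + 2)) - + 4 * + K (2 + m) ∎
  where open ≡-Reasoning
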